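{- Let $n$ be a positive integer with $n\equiv 3,7\pmod{12}$. Then for every odd positive integer $m$ and every positive integer $t\equiv 2\pmod 4$, there is no $3$-SCHGDD of type $(n,m^t)$.
   Context: Let $n,m,t$ be positive integers, $I_n=\{0,1,\dots,n-1\}$, $Z_{mt}$ the integers modulo $mt$, and $S=\{0,t,2t,\dots,(m-1)t\}\subseteq Z_{mt}$. A $3$-HGDD of type $(n,m^t)$ is a quadruple $(X,\mathcal G,\mathcal H,\mathcal B)$ where $X$ is a set of $nmt$ points, $\mathcal G$ is a partition of $X$ into $n$ groups of size $mt$, $\mathcal H$ is a partition of $X$ into $t$ holes of size $nm$ with $|H\cap G|=m$ for every $H\in\mathcal H$, $G\in\mathcal G$, and $\mathcal B$ is a collection of $3$-subsets of $X$ (blocks) such that no block contains two distinct points of the same group or of the same hole, while every other pair of distinct points of $X$ lies in exactly one block. A $3$-SCHGDD of type $(n,m^t)$ is a $3$-HGDD of type $(n,m^t)$ which, up to isomorphism, has $X=I_n\times Z_{mt}$, groups $\{i\}\times Z_{mt}$ ($i\in I_n$), holes $I_n\times(S+l)$ ($0\le l\le t-1$), and block set invariant under $(i,x)\mapsto (i,x+1 \bmod mt)$. -}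

module Defs where

open import Data.Nat using (ℕ; zero; suc; _+_; _*_; ∣_-_∣; _%_)
open import Data.Nat.DivMod using (m%n<n)
open import Data.Nat.Divisibility using (_∣_)
open import Data.Fin using (Fin; toℕ; fromℕ<)
open import Data.Product using (Σ; _×_; _,_; ∃)
open import Data.Sum using (_⊎_)
open import Relation.Binary.PropositionalEquality using (_≡_; _≢_)
open import Function.Bundles using (_⇔_)

rot : ∀ {k} → Fin k → Fin k
rot {suc k} x = fromℕ< (m%n<n (suc (toℕ x)) (suc k))

record Point (n m t : ℕ) : Set where
  constructor ⟨_,_⟩
  field
    grp : Fin n
    pos : Fin (m * t)

SameGroup : ∀ {n m t} → Point n m t → Point n m t → Set
SameGroup ⟨ i , _ ⟩ ⟨ j , _ ⟩ = i ≡ j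

-- the hole of (i , x) is I_n × (S + l) where x ≡ l (mod t), S = {0,t,...,(m-1)t}
SameHole : ∀ {n m t} → Point n m t → Point n m t → Set
SameHole {t = t} ⟨ _ , x ⟩ ⟨ _ , y ⟩ = t ∣ ∣ toℕ x - toℕ y ∣

Admissible : ∀ {n m t} → Point n m t → Point n m t → Set
Admissible p q = (SameGroup p q → Data.Empty.⊥) × (SameHole p q → Data.Empty.⊥)
  where import Data.Empty

-- a block is written as a triple (a , b , c) representing the 3-set {a , b , c}
Block : ℕ → ℕ → ℕ → Set
Block n m t = Point n m t × Point n m t × Point n m t

_∈B_ : ∀ {n m t} → Point n m t → Block n m t → Set
p ∈B (a , b , c) = p ≡ a ⊎ p ≡ b ⊎ p ≡ c

ValidBlock : ∀ {n m t} → Block n m t → Set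
ValidBlock (a , b , c) = Admissible a b × Admissible a c × Admissible b c

rotB : ∀ {n m t} → Block n m t → Block n m t
rotB (⟨ i , x ⟩ , ⟨ j , y ⟩ , ⟨ k , z ⟩) = ⟨ i , rot x ⟩ , ⟨ j , rot y ⟩ , ⟨ k , rot z ⟩

-- A 3-SCHGDD of type (n, m^t) in its standard form: a finite collection
-- B : Fin k → Block of blocks on I_n × Z_{mt} (standard groups and holes) such that
--  * every block consists of 3 points pairwise in distinct groups and distinct holes,
--  * every admissible pair of distinct points lies in exactly one block,
--  * the block collection is invariant under (i , x) ↦ (i , x + 1 mod mt).
SCHGDD : ℕ → ℕ → ℕ → Set
SCHGDD n m t =
  Σ ℕ λ k → Σ (Fin k → Block n m t) λ B →
    ((r : Fin k) → ValidBlock (B r))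
  × ((p q : Point n m t) → p ≢ q → Admissible p q →
       Σ (Fin k) λ r → (p ∈B B r × q ∈B B r)
         × ((s : Fin k) → p ∈B B s → q ∈B B s → s ≡ r))
  × ((r : Fin k) → Σ (Fin k) λ s → (p : Point n m t) → (p ∈B B s) ⇔ (p ∈B rotB (B r)))

module Submission where

-- Proof idea: a parity count of "odd edges".
--
-- Let D be a 3-SCHGDD of type (n, m^t) on I_n × Z_M, M = mt, with t even.
-- An edge (i , j , d) with i < j stands for the translation orbit of the pair
-- {(i , 0) , (j , d)}; it is odd when d is odd.  Since t is even, the two
-- points of an odd pair lie in different holes, so they lie in a unique block
-- {p , q , z}.  Since M is even, a pair is odd exactly when its two positions
-- have different parity, so among the three sides of a block an even number
-- is odd: the odd side pq has exactly one odd "partner" side through z.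
-- Translation invariance of the block set turns this into a fixed-point-free
-- involution on odd edges, so their number C(n,2) · M/2 is even.  For
-- n ≡ 3, 7 (mod 12), m odd and t ≡ 2 (mod 4) that number is odd.

open import Defs
open import Data.Nat as ℕ
  using (ℕ; zero; suc; _+_; _*_; _∸_; _%_; _/_; _<_; _<?_; z≤n; s≤s)
open import Data.Nat.Properties
  using ( +-0-commutativeMonoid; +-comm; +-suc; +-identityʳ; *-assoc; m+[n∸m]≡n
        ; <⇒≤; <-irrefl; <-asym; <-cmp; <-irrelevant; ≤∧≢⇒<; ≮⇒≥; ∣-∣-comm)
open import Data.Nat.DivMod
  using ( m%n<n; %-distribˡ-+; m%n%n≡m%n; n%n≡0; m<n⇒m%n≡m; m≡m%n+[m/n]*n
        ; m∣n⇒o%n%m≡o%m)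
open import Data.Nat.Divisibility using (_∣_; _∣?_; divides; ∣-trans)
open import Data.Nat.Solver using (module +-*-Solver)
open import Data.Fin using (Fin; toℕ)
open import Data.Fin.Properties using (_≟_; toℕ-injective; toℕ-fromℕ<; toℕ<n; +↔⊎; *↔×)
open import Data.Fin.Permutation using (permutation)
open import Data.Parity as ℙ using (Parity; 0ℙ; 1ℙ; _⁻¹)
import Data.Parity.Properties as ℙP
open import Data.Product using (Σ; _×_; _,_; proj₁; proj₂; uncurry)
open import Data.Product.Function.NonDependent.Propositional using (_×-↔_)
open import Data.Sum using (_⊎_; inj₁; inj₂; [_,_]′)
open import Data.Sum.Function.Propositional using (_⊎-↔_)
open import Data.Empty using (⊥-elim)
open import Function using (_∘_)
open import Function.Bundles using (_↔_; _⇔_; mk↔ₛ′; Inverse; Equivalence)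
open import Function.Properties.Inverse using (↔-refl; ↔-trans)
open import Relation.Binary using (tri<; tri≈; tri>)
open import Relation.Binary.PropositionalEquality
open import Relation.Nullary using (¬_; Dec; yes; no)
open import Relation.Nullary.Decidable using (¬?; _×-dec_)
open import Axiom.UniquenessOfIdentityProofs using (module Decidable⇒UIP)
import Algebra.Properties.CommutativeMonoid.Sum as Sum

-- A fixed-point-free involution on a finite set of size N forces N to be even:
-- the indicator of "x precedes its partner" counts each orbit exactly once.
module _ {N : ℕ} (f : Fin N → Fin N) (involutive : ∀ x → f (f x) ≡ x)
         (fixedPointFree : ∀ x → f x ≢ x) where

  open Sum +-0-commutativeMonoid using (sum; sum-cong-≗; ∑-distrib-+; ∑-permute)

  isFirst : Fin N → ℕ
  isFirst x with toℕ x <? toℕ (f x)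
  ... | yes _ = 1
  ... | no _ = 0

  isFirst-orbit : ∀ x → isFirst x + isFirst (f x) ≡ 1
  isFirst-orbit x with toℕ x <? toℕ (f x) | toℕ (f x) <? toℕ (f (f x))
  ... | yes x<fx | yes fx<ffx = ⊥-elim (<-asym x<fx (subst (λ y → toℕ (f x) < toℕ y) (involutive x) fx<ffx))
  ... | yes _ | no _ = refl
  ... | no _ | yes _ = refl
  ... | no x≮fx | no fx≮ffx with <-cmp (toℕ x) (toℕ (f x))
  ...   | tri< x<fx _ _ = ⊥-elim (x≮fx x<fx)
  ...   | tri≈ _ x≡fx _ = ⊥-elim (fixedPointFree x (toℕ-injective (sym x≡fx)))
  ...   | tri> _ _ fx<x = ⊥-elim (fx≮ffx (subst (λ y → toℕ (f x) < toℕ y) (sym (involutive x)) fx<x))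

  sum-ones : ∀ {K} → sum {K} (λ _ → 1) ≡ K
  sum-ones {zero} = refl
  sum-ones {suc K} = cong suc (sum-ones {K})

  involution-even : Σ ℕ λ k → N ≡ k + k
  involution-even = sum isFirst , (begin
    N                                  ≡⟨ sym sum-ones ⟩
    sum {N} (λ _ → 1)                  ≡⟨ sum-cong-≗ (λ x → sym (isFirst-orbit x)) ⟩
    sum (λ x → isFirst x + isFirst (f x)) ≡⟨ ∑-distrib-+ isFirst (isFirst ∘ f) ⟩
    sum isFirst + sum (isFirst ∘ f)    ≡⟨ cong (sum isFirst +_) (sym (∑-permute isFirst (permutation f f involutive involutive))) ⟩
    sum isFirst + sum isFirst          ∎)
    where open ≡-Reasoning

involution-even-↔ : ∀ {N} {A : Set} → Fin N ↔ A → (f : A → A) →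
  (∀ x → f (f x) ≡ x) → (∀ x → f x ≢ x) → Σ ℕ λ k → N ≡ k + k
involution-even-↔ {N} enum f involutive fixedPointFree =
  involution-even f′ involutive′ fixedPointFree′
  where
  open Inverse enum using (to; from; strictlyInverseˡ; strictlyInverseʳ)
  f′ : Fin N → Fin N
  f′ = from ∘ f ∘ to
  involutive′ : ∀ y → f′ (f′ y) ≡ y
  involutive′ y = begin
    from (f (to (from (f (to y))))) ≡⟨ cong (from ∘ f) (strictlyInverseˡ (f (to y))) ⟩
    from (f (f (to y)))             ≡⟨ cong from (involutive (to y)) ⟩
    from (to y)                     ≡⟨ strictlyInverseʳ y ⟩
    y                               ∎
    where open ≡-Reasoning
  fixedPointFree′ : ∀ y → f′ y ≢ y
  fixedPointFree′ y eq = fixedPointFree (to y) (trans (sym (strictlyInverseˡ (f (to y)))) (cong to eq))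

-- T n = n(n-1)/2, the number of pairs i < j in Fin n.
T : ℕ → ℕ
T zero = 0
T (suc n) = n + T n

Pairs : ℕ → Set
Pairs n = Σ (Fin n × Fin n) λ (i , j) → toℕ i < toℕ j

pairs-suc↔ : ∀ {n} → (Fin n ⊎ Pairs n) ↔ Pairs (suc n)
pairs-suc↔ {n} = mk↔ₛ′ to from to∘from from∘to
  where
  to : Fin n ⊎ Pairs n → Pairs (suc n)
  to (inj₁ j) = (Fin.zero , Fin.suc j) , s≤s z≤n
  to (inj₂ ((i , j) , i<j)) = (Fin.suc i , Fin.suc j) , s≤s i<j
  from : Pairs (suc n) → Fin n ⊎ Pairs n
  from ((Fin.zero , Fin.suc j) , _) = inj₁ j
  from ((Fin.suc i , Fin.suc j) , s≤s i<j) = inj₂ ((i , j) , i<j)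
  to∘from : ∀ p → to (from p) ≡ p
  to∘from ((Fin.zero , Fin.suc j) , s≤s z≤n) = refl
  to∘from ((Fin.suc i , Fin.suc j) , s≤s i<j) = refl
  from∘to : ∀ x → from (to x) ≡ x
  from∘to (inj₁ j) = refl
  from∘to (inj₂ _) = refl

-- T n counts the increasing pairs: Fin (n + T n) splits as Fin n ⊎ Fin (T n)
pairs↔ : ∀ n → Fin (T n) ↔ Pairs n
pairs↔ zero = mk↔ₛ′ (λ ()) (λ { ((() , _) , _) }) (λ { ((() , _) , _) }) (λ ())
pairs↔ (suc n) = ↔-trans +↔⊎ (↔-trans (↔-refl ⊎-↔ pairs↔ n) pairs-suc↔)

OddFin : ℕ → Set
OddFin M = Σ (Fin M) λ d → ℕ.parity (toℕ d) ≡ 1ℙ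

-- w ↦ 2w + 1, built by peeling off the two smallest residues
odd↔ : ∀ h → Fin h ↔ OddFin (h * 2)
odd↔ zero = mk↔ₛ′ (λ ()) (λ { (() , _) }) (λ { (() , _) }) (λ ())
odd↔ (suc h) = mk↔ₛ′ to from to∘from from∘to
  where
  open Inverse (odd↔ h) renaming (to to to′; from to from′)
  shift2 : OddFin (h * 2) → OddFin (suc h * 2)
  shift2 (d , odd) = Fin.suc (Fin.suc d) , odd
  to : Fin (suc h) → OddFin (suc h * 2)
  to Fin.zero = Fin.suc Fin.zero , refl
  to (Fin.suc w) = shift2 (to′ w)
  from : OddFin (suc h * 2) → Fin (suc h)
  from (Fin.suc Fin.zero , _) = Fin.zero
  from (Fin.suc (Fin.suc d) , odd) = Fin.suc (from′ (d , odd))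
  to∘from : ∀ x → to (from x) ≡ x
  to∘from (Fin.suc Fin.zero , refl) = refl
  to∘from (Fin.suc (Fin.suc d) , odd) = cong shift2 (strictlyInverseˡ (d , odd))
  from∘to : ∀ w → from (to w) ≡ w
  from∘to Fin.zero = refl
  from∘to (Fin.suc w) = cong Fin.suc (strictlyInverseʳ w)

odd↔-≡ : ∀ {M} h → M ≡ h * 2 → Fin h ↔ OddFin M
odd↔-≡ h refl = odd↔ h

parity-+-even : ∀ a k → ℕ.parity (a + k * 2) ≡ ℕ.parity a
parity-+-even a k = begin
  ℕ.parity (a + k * 2)                       ≡⟨ ℙP.+-homo-+ a (k * 2) ⟩
  ℕ.parity a ℙ.+ ℕ.parity (k * 2)            ≡⟨ cong (ℕ.parity a ℙ.+_) (ℙP.*-homo-* k 2) ⟩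
  ℕ.parity a ℙ.+ (ℕ.parity k ℙ.* 0ℙ)        ≡⟨ cong (ℕ.parity a ℙ.+_) (ℙP.*-zeroʳ (ℕ.parity k)) ⟩
  ℕ.parity a ℙ.+ 0ℙ                          ≡⟨ ℙP.+-identityʳ (ℕ.parity a) ⟩
  ℕ.parity a                                 ∎
  where open ≡-Reasoning

module Cyclic (K : ℕ) where

  M : ℕ
  M = suc K

  shift : ℕ → Fin M → Fin M
  shift zero x = x
  shift (suc c) x = rot (shift c x)

  shift-+ : ∀ a b x → shift a (shift b x) ≡ shift (a + b) x
  shift-+ zero b x = refl
  shift-+ (suc a) b x = cong rot (shift-+ a b x)

  shift-comm : ∀ a b x → shift a (shift b x) ≡ shift b (shift a x)
  shift-comm a b x = trans (shift-+ a b x) (trans (cong (λ c → shift c x) (+-comm a b)) (sym (shift-+ b a x)))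

  suc-% : ∀ a → suc (a % M) % M ≡ suc a % M
  suc-% a = begin
    (1 + a % M) % M            ≡⟨ %-distribˡ-+ 1 (a % M) M ⟩
    (1 % M + a % M % M) % M    ≡⟨ cong (λ r → (1 % M + r) % M) (m%n%n≡m%n a M) ⟩
    (1 % M + a % M) % M        ≡⟨ sym (%-distribˡ-+ 1 a M) ⟩
    (1 + a) % M                ∎
    where open ≡-Reasoning

  toℕ-shift : ∀ c x → toℕ (shift c x) ≡ (toℕ x + c) % M
  toℕ-shift zero x = sym (trans (cong (_% M) (+-identityʳ (toℕ x))) (m<n⇒m%n≡m (toℕ<n x)))
  toℕ-shift (suc c) x = begin
    toℕ (rot (shift c x))          ≡⟨ toℕ-fromℕ< (m%n<n (suc (toℕ (shift c x))) M) ⟩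
    suc (toℕ (shift c x)) % M      ≡⟨ cong (λ r → suc r % M) (toℕ-shift c x) ⟩
    suc ((toℕ x + c) % M) % M      ≡⟨ suc-% (toℕ x + c) ⟩
    suc (toℕ x + c) % M            ≡⟨ cong (_% M) (sym (+-suc (toℕ x) c)) ⟩
    (toℕ x + suc c) % M            ∎
    where open ≡-Reasoning

  shift-% : ∀ c x → shift (c % M) x ≡ shift c x
  shift-% c x = toℕ-injective (begin
    toℕ (shift (c % M) x)          ≡⟨ toℕ-shift (c % M) x ⟩
    (toℕ x + c % M) % M            ≡⟨ %-distribˡ-+ (toℕ x) (c % M) M ⟩
    (toℕ x % M + c % M % M) % M    ≡⟨ cong (λ r → (toℕ x % M + r) % M) (m%n%n≡m%n c M) ⟩
    (toℕ x % M + c % M) % M        ≡⟨ sym (%-distribˡ-+ (toℕ x) c M) ⟩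
    (toℕ x + c) % M                ≡⟨ sym (toℕ-shift c x) ⟩
    toℕ (shift c x)                ∎)
    where open ≡-Reasoning

  shift-zero : ∀ d → shift (toℕ d) Fin.zero ≡ d
  shift-zero d = toℕ-injective (trans (toℕ-shift (toℕ d) Fin.zero) (m<n⇒m%n≡m (toℕ<n d)))

  shift-neg : ∀ x → shift (M ∸ toℕ x) x ≡ Fin.zero
  shift-neg x = toℕ-injective (begin
    toℕ (shift (M ∸ toℕ x) x)      ≡⟨ toℕ-shift (M ∸ toℕ x) x ⟩
    (toℕ x + (M ∸ toℕ x)) % M      ≡⟨ cong (_% M) (m+[n∸m]≡n (<⇒≤ (toℕ<n x))) ⟩
    M % M                          ≡⟨ n%n≡0 M ⟩
    0                              ∎)
    where open ≡-Reasoning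

  unshift : ∀ d z → shift (M ∸ toℕ z) (shift (toℕ d) z) ≡ d
  unshift d z = begin
    shift (M ∸ toℕ z) (shift (toℕ d) z)  ≡⟨ shift-comm (M ∸ toℕ z) (toℕ d) z ⟩
    shift (toℕ d) (shift (M ∸ toℕ z) z)  ≡⟨ cong (shift (toℕ d)) (shift-neg z) ⟩
    shift (toℕ d) Fin.zero               ≡⟨ shift-zero d ⟩
    d                                    ∎
    where open ≡-Reasoning

  shift-cancel : ∀ {d d′} z → shift (toℕ d) z ≡ shift (toℕ d′) z → d ≡ d′
  shift-cancel {d} {d′} z eq = trans (sym (unshift d z)) (trans (cong (shift (M ∸ toℕ z)) eq) (unshift d′ z))

  _⊖_ : Fin M → Fin M → Fin M
  y ⊖ x = shift (M ∸ toℕ x) y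

  ⊖-spec : ∀ y x → shift (toℕ (y ⊖ x)) x ≡ y
  ⊖-spec y x = begin
    shift (toℕ (y ⊖ x)) x                ≡⟨ cong (λ c → shift c x) (toℕ-shift (M ∸ toℕ x) y) ⟩
    shift ((toℕ y + (M ∸ toℕ x)) % M) x  ≡⟨ shift-% (toℕ y + (M ∸ toℕ x)) x ⟩
    shift (toℕ y + (M ∸ toℕ x)) x        ≡⟨ sym (shift-+ (toℕ y) (M ∸ toℕ x) x) ⟩
    shift (toℕ y) (shift (M ∸ toℕ x) x)  ≡⟨ cong (shift (toℕ y)) (shift-neg x) ⟩
    shift (toℕ y) Fin.zero               ≡⟨ shift-zero y ⟩
    y                                    ∎
    where open ≡-Reasoning

  ⊖-zero : ∀ y → y ⊖ Fin.zero ≡ y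
  ⊖-zero y = shift-cancel Fin.zero (trans (⊖-spec y Fin.zero) (sym (shift-zero y)))

  ⊖-shift : ∀ c y x → shift c y ⊖ shift c x ≡ y ⊖ x
  ⊖-shift c y x = shift-cancel (shift c x) (begin
    shift (toℕ (shift c y ⊖ shift c x)) (shift c x) ≡⟨ ⊖-spec (shift c y) (shift c x) ⟩
    shift c y                                       ≡⟨ cong (shift c) (sym (⊖-spec y x)) ⟩
    shift c (shift (toℕ (y ⊖ x)) x)                 ≡⟨ shift-comm c (toℕ (y ⊖ x)) x ⟩
    shift (toℕ (y ⊖ x)) (shift c x)                 ∎)
    where open ≡-Reasoning

  -- When M is even, the parity of a residue is well defined and translation
  -- by one flips it.
  module EvenModulus (h : ℕ) (M≡h*2 : M ≡ h * 2) where

    par : Fin M → Parity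
    par x = ℕ.parity (toℕ x)

    parity-% : ∀ a → ℕ.parity (a % M) ≡ ℕ.parity a
    parity-% a = begin
      ℕ.parity (a % M)                         ≡⟨ sym (parity-+-even (a % M) ((a / M) * h)) ⟩
      ℕ.parity (a % M + (a / M) * h * 2)       ≡⟨ cong (λ r → ℕ.parity (a % M + r)) (*-assoc (a / M) h 2) ⟩
      ℕ.parity (a % M + (a / M) * (h * 2))     ≡⟨ cong (λ r → ℕ.parity (a % M + (a / M) * r)) (sym M≡h*2) ⟩
      ℕ.parity (a % M + (a / M) * M)           ≡⟨ cong ℕ.parity (sym (m≡m%n+[m/n]*n a M)) ⟩
      ℕ.parity a                               ∎
      where open ≡-Reasoning

    par-rot : ∀ x → par (rot x) ≡ par x ⁻¹
    par-rot x = begin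
      ℕ.parity (toℕ (rot x))        ≡⟨ cong ℕ.parity (toℕ-fromℕ< (m%n<n (suc (toℕ x)) M)) ⟩
      ℕ.parity (suc (toℕ x) % M)    ≡⟨ parity-% (suc (toℕ x)) ⟩
      ℕ.parity (suc (toℕ x))        ≡⟨ sym (ℙP.⁻¹-selfInverse (ℙP.suc-homo-⁻¹ (toℕ x))) ⟩
      ℕ.parity (toℕ x) ⁻¹           ∎
      where open ≡-Reasoning

module Blocks {n m t : ℕ} where

  open Point

  Pt : Set
  Pt = Point n m t

  admissible-sym : ∀ {x y : Pt} → Admissible x y → Admissible y x
  admissible-sym {x} {y} (¬group , ¬hole) =
    (λ eq → ¬group (sym eq)) ,
    (λ t∣ → ¬hole (subst (t ∣_) (∣-∣-comm (toℕ (pos y)) (toℕ (pos x))) t∣))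

  member-admissible : ∀ {x y : Pt} (bl : Block n m t) → ValidBlock bl →
    x ∈B bl → y ∈B bl → grp x ≢ grp y → Admissible x y
  member-admissible _ _ (inj₁ refl) (inj₁ refl) ne = ⊥-elim (ne refl)
  member-admissible _ (ab , _ , _) (inj₁ refl) (inj₂ (inj₁ refl)) _ = ab
  member-admissible _ (_ , ac , _) (inj₁ refl) (inj₂ (inj₂ refl)) _ = ac
  member-admissible (a , b , _) (ab , _ , _) (inj₂ (inj₁ refl)) (inj₁ refl) _ = admissible-sym {a} {b} ab
  member-admissible _ _ (inj₂ (inj₁ refl)) (inj₂ (inj₁ refl)) ne = ⊥-elim (ne refl)
  member-admissible _ (_ , _ , bc) (inj₂ (inj₁ refl)) (inj₂ (inj₂ refl)) _ = bc
  member-admissible (a , _ , c) (_ , ac , _) (inj₂ (inj₂ refl)) (inj₁ refl) _ = admissible-sym {a} {c} ac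
  member-admissible (_ , b , c) (_ , _ , bc) (inj₂ (inj₂ refl)) (inj₂ (inj₁ refl)) _ = admissible-sym {b} {c} bc
  member-admissible _ _ (inj₂ (inj₂ refl)) (inj₂ (inj₂ refl)) ne = ⊥-elim (ne refl)

  other₃ : ∀ {x a b c : Pt} → x ∈B (a , b , c) → x ≢ a → x ≢ b → x ≡ c
  other₃ (inj₁ eq) ≢a _ = ⊥-elim (≢a eq)
  other₃ (inj₂ (inj₁ eq)) _ ≢b = ⊥-elim (≢b eq)
  other₃ (inj₂ (inj₂ eq)) _ _ = eq

  other₂ : ∀ {x a b c : Pt} → x ∈B (a , b , c) → x ≢ a → x ≢ c → x ≡ b
  other₂ (inj₁ eq) ≢a _ = ⊥-elim (≢a eq)
  other₂ (inj₂ (inj₁ eq)) _ _ = eq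
  other₂ (inj₂ (inj₂ eq)) _ ≢c = ⊥-elim (≢c eq)

  other₁ : ∀ {x a b c : Pt} → x ∈B (a , b , c) → x ≢ b → x ≢ c → x ≡ a
  other₁ (inj₁ eq) _ _ = eq
  other₁ (inj₂ (inj₁ eq)) ≢b _ = ⊥-elim (≢b eq)
  other₁ (inj₂ (inj₂ eq)) _ ≢c = ⊥-elim (≢c eq)

  third-member-unique : ∀ {x y z w : Pt} (bl : Block n m t) →
    x ∈B bl → y ∈B bl → z ∈B bl → w ∈B bl →
    x ≢ y → x ≢ z → y ≢ z → x ≢ w → y ≢ w → z ≡ w
  third-member-unique {x} {y} {z} {w} (a , b , c) x∈ y∈ z∈ w∈ x≢y x≢z y≢z x≢w y≢w = go z∈ w∈
    where
    go : z ∈B (a , b , c) → w ∈B (a , b , c) → z ≡ w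
    go (inj₁ refl) (inj₁ refl) = refl
    go (inj₂ (inj₁ refl)) (inj₂ (inj₁ refl)) = refl
    go (inj₂ (inj₂ refl)) (inj₂ (inj₂ refl)) = refl
    go (inj₁ refl) (inj₂ (inj₁ refl)) = ⊥-elim (x≢y (trans (other₃ x∈ x≢z x≢w) (sym (other₃ y∈ y≢z y≢w))))
    go (inj₁ refl) (inj₂ (inj₂ refl)) = ⊥-elim (x≢y (trans (other₂ x∈ x≢z x≢w) (sym (other₂ y∈ y≢z y≢w))))
    go (inj₂ (inj₁ refl)) (inj₁ refl) = ⊥-elim (x≢y (trans (other₃ x∈ x≢w x≢z) (sym (other₃ y∈ y≢w y≢z))))
    go (inj₂ (inj₁ refl)) (inj₂ (inj₂ refl)) = ⊥-elim (x≢y (trans (other₁ x∈ x≢z x≢w) (sym (other₁ y∈ y≢z y≢w))))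
    go (inj₂ (inj₂ refl)) (inj₁ refl) = ⊥-elim (x≢y (trans (other₂ x∈ x≢w x≢z) (sym (other₂ y∈ y≢w y≢z))))
    go (inj₂ (inj₂ refl)) (inj₂ (inj₁ refl)) = ⊥-elim (x≢y (trans (other₁ x∈ x≢w x≢z) (sym (other₁ y∈ y≢w y≢z))))

  avoid : Fin n → Fin n → Pt → Pt → Pt
  avoid gp gq x y with grp x ≟ gp | grp x ≟ gq
  ... | no _ | no _ = x
  ... | _ | _ = y

  avoid-spec : ∀ gp gq (x y : Pt) →
    (avoid gp gq x y ≡ x × grp x ≢ gp × grp x ≢ gq) ⊎ (avoid gp gq x y ≡ y × (grp x ≡ gp ⊎ grp x ≡ gq))
  avoid-spec gp gq x y with grp x ≟ gp | grp x ≟ gq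
  ... | no ≢p | no ≢q = inj₁ (refl , ≢p , ≢q)
  ... | yes ≡p | _ = inj₂ (refl , inj₁ ≡p)
  ... | no _ | yes ≡q = inj₂ (refl , inj₂ ≡q)

  outside : Fin n → Fin n → Block n m t → Pt
  outside gp gq (x , y , z) = avoid gp gq x (avoid gp gq y z)

  outside-spec : ∀ gp gq (bl : Block n m t) → ValidBlock bl →
    outside gp gq bl ∈B bl × grp (outside gp gq bl) ≢ gp × grp (outside gp gq bl) ≢ gq
  outside-spec gp gq (x , y , z) ((x≁y , _) , (x≁z , _) , (y≁z , _))
    with avoid-spec gp gq x (avoid gp gq y z)
  ... | inj₁ (eq , ≢p , ≢q) rewrite eq = inj₁ refl , ≢p , ≢q
  ... | inj₂ (eq , x∈) rewrite eq with avoid-spec gp gq y z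
  ...   | inj₁ (eq′ , ≢p , ≢q) rewrite eq′ = inj₂ (inj₁ refl) , ≢p , ≢q
  ...   | inj₂ (eq′ , y∈) rewrite eq′ = inj₂ (inj₂ refl) , z≢ x∈ y∈ , z≢′ x∈ y∈
    where
    -- x and y occupy the two groups gp, gq; z lies in neither
    z≢ : (grp x ≡ gp ⊎ grp x ≡ gq) → (grp y ≡ gp ⊎ grp y ≡ gq) → grp z ≢ gp
    z≢ (inj₁ xp) _ zp = x≁z (trans xp (sym zp))
    z≢ (inj₂ _) (inj₁ yp) zp = y≁z (trans yp (sym zp))
    z≢ (inj₂ xq) (inj₂ yq) _ = x≁y (trans xq (sym yq))
    z≢′ : (grp x ≡ gp ⊎ grp x ≡ gq) → (grp y ≡ gp ⊎ grp y ≡ gq) → grp z ≢ gq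
    z≢′ (inj₂ xq) _ zq = x≁z (trans xq (sym zq))
    z≢′ (inj₁ _) (inj₂ yq) zq = y≁z (trans yq (sym zq))
    z≢′ (inj₁ xp) (inj₁ yp) _ = x≁y (trans xp (sym yp))

odd-odd : ∀ a b c → a ℙ.+ b ≡ 1ℙ → a ℙ.+ c ≡ 1ℙ → c ℙ.+ b ≡ 0ℙ
odd-odd 0ℙ 0ℙ _ () _
odd-odd 0ℙ 1ℙ 0ℙ _ ()
odd-odd 0ℙ 1ℙ 1ℙ _ _ = refl
odd-odd 1ℙ 0ℙ 0ℙ _ _ = refl
odd-odd 1ℙ 0ℙ 1ℙ _ ()
odd-odd 1ℙ 1ℙ _ () _

odd-even : ∀ a b c → a ℙ.+ b ≡ 1ℙ → a ℙ.+ c ≡ 0ℙ → b ℙ.+ c ≡ 1ℙ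
odd-even 0ℙ 0ℙ _ () _
odd-even 0ℙ 1ℙ 0ℙ _ _ = refl
odd-even 0ℙ 1ℙ 1ℙ _ ()
odd-even 1ℙ 0ℙ 0ℙ _ ()
odd-even 1ℙ 0ℙ 1ℙ _ _ = refl
odd-even 1ℙ 1ℙ _ () _

⁻¹+⁻¹ : ∀ a b → a ⁻¹ ℙ.+ b ⁻¹ ≡ a ℙ.+ b
⁻¹+⁻¹ 0ℙ 0ℙ = refl
⁻¹+⁻¹ 0ℙ 1ℙ = refl
⁻¹+⁻¹ 1ℙ 0ℙ = refl
⁻¹+⁻¹ 1ℙ 1ℙ = refl

parity-cases : ∀ s → s ≡ 1ℙ ⊎ s ≡ 0ℙ
parity-cases 1ℙ = inj₁ refl
parity-cases 0ℙ = inj₂ refl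

module Design {n a b : ℕ} (D : SCHGDD n (suc a) (suc b)) (half : ℕ) (t≡half*2 : suc b ≡ half * 2) where

  open Point
  open Blocks {n} {suc a} {suc b}
  open Cyclic (b + a * suc b)

  t : ℕ
  t = suc b

  h : ℕ
  h = suc a * half

  M≡h*2 : M ≡ h * 2
  M≡h*2 = trans (cong (suc a *_) t≡half*2) (sym (*-assoc (suc a) half 2))

  open EvenModulus h M≡h*2

  numBlocks : ℕ
  numBlocks = proj₁ D

  block : Fin numBlocks → Block n (suc a) t
  block = proj₁ (proj₂ D)

  valid : ∀ r → ValidBlock (block r)
  valid = proj₁ (proj₂ (proj₂ D))

  covered : (p q : Pt) → p ≢ q → Admissible p q →
    Σ (Fin numBlocks) λ r → (p ∈B block r × q ∈B block r)
      × (∀ s → p ∈B block s → q ∈B block s → s ≡ r)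
  covered = proj₁ (proj₂ (proj₂ (proj₂ D)))

  invariant : ∀ r → Σ (Fin numBlocks) λ s → ∀ p → (p ∈B block s) ⇔ (p ∈B rotB (block r))
  invariant = proj₂ (proj₂ (proj₂ (proj₂ D)))

  shiftP : ℕ → Pt → Pt
  shiftP c p = ⟨ grp p , shift c (pos p) ⟩

  Collinear : Pt → Pt → Pt → Set
  Collinear p q z = Σ (Fin numBlocks) λ r → p ∈B block r × q ∈B block r × z ∈B block r

  Triangle : Pt → Pt → Pt → Set
  Triangle p q z = Collinear p q z × grp p ≢ grp q × grp p ≢ grp z × grp q ≢ grp z

  triangle-132 : ∀ {p q z} → Triangle p q z → Triangle p z q
  triangle-132 ((r , p∈ , q∈ , z∈) , pq , pz , qz) = (r , p∈ , z∈ , q∈) , pz , pq , (λ eq → qz (sym eq))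

  triangle-213 : ∀ {p q z} → Triangle p q z → Triangle q p z
  triangle-213 ((r , p∈ , q∈ , z∈) , pq , pz , qz) = (r , q∈ , p∈ , z∈) , (λ eq → pq (sym eq)) , qz , pz

  rot-member : ∀ {x} (bl : Block n (suc a) t) → x ∈B bl → shiftP 1 x ∈B rotB bl
  rot-member _ (inj₁ refl) = inj₁ refl
  rot-member _ (inj₂ (inj₁ refl)) = inj₂ (inj₁ refl)
  rot-member _ (inj₂ (inj₂ refl)) = inj₂ (inj₂ refl)

  collinear-rot : ∀ {p q z} → Collinear p q z → Collinear (shiftP 1 p) (shiftP 1 q) (shiftP 1 z)
  collinear-rot (r , p∈ , q∈ , z∈) = s , moved p∈ , moved q∈ , moved z∈
    where
    s : Fin numBlocks
    s = proj₁ (invariant r)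
    moved : ∀ {x} → x ∈B block r → shiftP 1 x ∈B block s
    moved {x} x∈ = Equivalence.from (proj₂ (invariant r) (shiftP 1 x)) (rot-member (block r) x∈)

  collinear-shift : ∀ c {p q z} → Collinear p q z → Collinear (shiftP c p) (shiftP c q) (shiftP c z)
  collinear-shift zero col = col
  collinear-shift (suc c) col = collinear-rot (collinear-shift c col)

  triangle-shift : ∀ c {p q z} → Triangle p q z → Triangle (shiftP c p) (shiftP c q) (shiftP c z)
  triangle-shift c (col , pq , pz , qz) = collinear-shift c col , pq , pz , qz

  same-block : ∀ {x y r s} → x ∈B block r → y ∈B block r → x ∈B block s → y ∈B block s →
    grp x ≢ grp y → r ≡ s
  same-block {x} {y} {r} {s} x∈r y∈r x∈s y∈s xy =
    trans (proj₂ (proj₂ cover) r x∈r y∈r) (sym (proj₂ (proj₂ cover) s x∈s y∈s))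
    where
    cover : Σ (Fin numBlocks) λ u → (x ∈B block u × y ∈B block u)
              × (∀ v → x ∈B block v → y ∈B block v → v ≡ u)
    cover = covered x y (λ eq → xy (cong grp eq)) (member-admissible (block r) (valid r) x∈r y∈r xy)

  triangle-unique : ∀ {p q z w} → Triangle p q z → Triangle p q w → z ≡ w
  triangle-unique ((r , p∈ , q∈ , z∈) , pq , pz , qz) ((s , p∈′ , q∈′ , w∈) , _ , pw , qw)
    with same-block p∈ q∈ p∈′ q∈′ pq
  ... | refl = third-member-unique (block r) p∈ q∈ z∈ w∈ (apart pq) (apart pz) (apart qz) (apart pw) (apart qw)
    where
    apart : ∀ {x y : Pt} → grp x ≢ grp y → x ≢ y
    apart ne eq = ne (cong grp eq)

  admissible? : (p q : Pt) → Dec (Admissible p q)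
  admissible? p q = ¬? (grp p ≟ grp q) ×-dec ¬? (t ∣? ℕ.∣ toℕ (pos p) - toℕ (pos q) ∣)

  -- kept opaque: the unfolding of third is large and only these two lemmas need it
  opaque
    -- the third point of the block through an admissible pair (junk otherwise)
    third : Pt → Pt → Pt
    third p q with admissible? p q
    ... | yes adm = outside (grp p) (grp q) (block (proj₁ (covered p q (λ eq → proj₁ adm (cong grp eq)) adm)))
    ... | no _ = p

    third-triangle : ∀ {p q} → Admissible p q → Triangle p q (third p q)
    third-triangle {p} {q} adm with admissible? p q
    ... | no ¬adm = ⊥-elim (¬adm adm)
    ... | yes adm′ with covered p q (λ eq → proj₁ adm′ (cong grp eq)) adm′
    ...   | r , (p∈ , q∈) , _ with outside-spec (grp p) (grp q) (block r) (valid r)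
    ...     | z∈ , zp , zq = (r , p∈ , q∈ , z∈) , proj₁ adm′ , (λ eq → zp (sym eq)) , (λ eq → zq (sym eq))

  third-unique : ∀ {p q z} → Triangle p q z → third p q ≡ z
  third-unique tri@((r , p∈ , q∈ , _) , pq , _ , _) =
    triangle-unique (third-triangle (member-admissible (block r) (valid r) p∈ q∈ pq)) tri

  side : Pt → Pt → Parity
  side p q = par (pos p) ℙ.+ par (pos q)

  side-shift : ∀ c p q → side (shiftP c p) (shiftP c q) ≡ side p q
  side-shift zero p q = refl
  side-shift (suc c) p q = begin
    par (rot (shift c (pos p))) ℙ.+ par (rot (shift c (pos q)))
      ≡⟨ cong₂ ℙ._+_ (par-rot (shift c (pos p))) (par-rot (shift c (pos q))) ⟩
    par (shift c (pos p)) ⁻¹ ℙ.+ par (shift c (pos q)) ⁻¹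
      ≡⟨ ⁻¹+⁻¹ (par (shift c (pos p))) (par (shift c (pos q))) ⟩
    side (shiftP c p) (shiftP c q)
      ≡⟨ side-shift c p q ⟩
    side p q ∎
    where open ≡-Reasoning

  -- An edge (i , j , d) stands for the translation orbit of the pair {(i , 0) , (j , d)}.
  Edge : Set
  Edge = Fin n × Fin n × Fin M

  rep : Edge → Pt × Pt
  rep (i , j , d) = ⟨ i , Fin.zero ⟩ , ⟨ j , d ⟩

  edge : Pt → Pt → Edge
  edge p q with toℕ (grp p) <? toℕ (grp q)
  ... | yes _ = grp p , grp q , pos q ⊖ pos p
  ... | no _ = grp q , grp p , pos p ⊖ pos q

  normalise : Pt → Pt → Pt × Pt
  normalise p q = shiftP (M ∸ toℕ (pos p)) p , shiftP (M ∸ toℕ (pos p)) q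

  normalise-rep : ∀ p q → normalise p q ≡ rep (grp p , grp q , pos q ⊖ pos p)
  normalise-rep p q = cong (λ x → ⟨ grp p , x ⟩ , ⟨ grp q , pos q ⊖ pos p ⟩) (shift-neg (pos p))

  rep-edge : ∀ p q → rep (edge p q) ≡ normalise p q ⊎ rep (edge p q) ≡ normalise q p
  rep-edge p q with toℕ (grp p) <? toℕ (grp q)
  ... | yes _ = inj₁ (sym (normalise-rep p q))
  ... | no _ = inj₂ (sym (normalise-rep q p))

  edge-shift : ∀ c p q → edge (shiftP c p) (shiftP c q) ≡ edge p q
  edge-shift c p q with toℕ (grp p) <? toℕ (grp q)
  ... | yes _ = cong (λ d → grp p , grp q , d) (⊖-shift c (pos q) (pos p))
  ... | no _ = cong (λ d → grp q , grp p , d) (⊖-shift c (pos p) (pos q))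

  flip-order : ∀ {i j : Fin n} → i ≢ j → ¬ toℕ i < toℕ j → toℕ j < toℕ i
  flip-order i≢j i≮j = ≤∧≢⇒< (≮⇒≥ i≮j) (λ eq → i≢j (toℕ-injective (sym eq)))

  edge-sym : ∀ {p q} → grp p ≢ grp q → edge p q ≡ edge q p
  edge-sym {p} {q} pq with toℕ (grp p) <? toℕ (grp q) | toℕ (grp q) <? toℕ (grp p)
  ... | yes p<q | yes q<p = ⊥-elim (<-asym p<q q<p)
  ... | yes _ | no _ = refl
  ... | no _ | yes _ = refl
  ... | no p≮q | no q≮p = ⊥-elim (q≮p (flip-order pq p≮q))

  edge-rep : ∀ {i j d} → toℕ i < toℕ j → uncurry edge (rep (i , j , d)) ≡ (i , j , d)
  edge-rep {i} {j} {d} i<j with toℕ i <? toℕ j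
  ... | yes _ = cong (λ x → i , j , x) (⊖-zero d)
  ... | no i≮j = ⊥-elim (i≮j i<j)

  edge-groups : ∀ {p q i j d} → edge p q ≡ (i , j , d) →
    (i ≡ grp p ⊎ i ≡ grp q) × (j ≡ grp p ⊎ j ≡ grp q)
  edge-groups {p} {q} eq with toℕ (grp p) <? toℕ (grp q)
  ... | yes _ = inj₁ (sym (cong proj₁ eq)) , inj₂ (sym (cong (proj₁ ∘ proj₂) eq))
  ... | no _ = inj₂ (sym (cong proj₁ eq)) , inj₁ (sym (cong (proj₁ ∘ proj₂) eq))

  OddEdge : Edge → Set
  OddEdge (i , j , d) = toℕ i < toℕ j × par d ≡ 1ℙ

  -- the difference of a pair has the parity of the pair (translate p to 0)
  par-⊖ : ∀ p q → par (pos q ⊖ pos p) ≡ side p q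
  par-⊖ p q = trans (cong (uncurry side) (sym (normalise-rep p q))) (side-shift (M ∸ toℕ (pos p)) p q)

  odd-edge : ∀ {p q} → grp p ≢ grp q → side p q ≡ 1ℙ → OddEdge (edge p q)
  odd-edge {p} {q} pq odd with toℕ (grp p) <? toℕ (grp q)
  ... | yes p<q = p<q , trans (par-⊖ p q) odd
  ... | no p≮q = flip-order pq p≮q , trans (par-⊖ q p) (trans (ℙP.+-comm (par (pos q)) (par (pos p))) odd)

  choose : Parity → Edge → Edge → Edge
  choose 1ℙ e _ = e
  choose 0ℙ _ e′ = e′

  choose-1ℙ : ∀ {s} e e′ → s ≡ 1ℙ → choose s e e′ ≡ e
  choose-1ℙ _ _ refl = refl

  choose-0ℙ : ∀ {s} e e′ → s ≡ 0ℙ → choose s e e′ ≡ e′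
  choose-0ℙ _ _ refl = refl

  -- In a triangle p q z with odd side pq exactly one of pz, qz is odd; this is
  -- the edge of that other odd side.
  oddSide : Pt → Pt → Pt → Edge
  oddSide p q z = choose (side p z) (edge p z) (edge q z)

  oddSide-shift : ∀ c p q z → oddSide (shiftP c p) (shiftP c q) (shiftP c z) ≡ oddSide p q z
  oddSide-shift c p q z rewrite side-shift c p z | edge-shift c p z | edge-shift c q z = refl

  step : Pt × Pt → Edge
  step (p , q) = oddSide p q (third p q)

  partner : Edge → Edge
  partner e = step (rep e)

  step-shift : ∀ c {p q z} → Triangle p q z → step (shiftP c p , shiftP c q) ≡ oddSide p q z
  step-shift c {p} {q} {z} tri = trans (cong (oddSide (shiftP c p) (shiftP c q)) (third-unique (triangle-shift c tri)))
                                       (oddSide-shift c p q z)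

  partner-edge-cases : ∀ {p q z} → Triangle p q z →
    partner (edge p q) ≡ oddSide p q z ⊎ partner (edge p q) ≡ oddSide q p z
  partner-edge-cases {p} {q} tri with rep-edge p q
  ... | inj₁ eq = inj₁ (trans (cong step eq) (step-shift (M ∸ toℕ (pos p)) tri))
  ... | inj₂ eq = inj₂ (trans (cong step eq) (step-shift (M ∸ toℕ (pos q)) (triangle-213 tri)))

  partner-of-edge : ∀ {x y w} → Triangle x y w → side x w ≡ 1ℙ → side y w ≡ 0ℙ →
    partner (edge x y) ≡ edge x w
  partner-of-edge {x} {y} {w} tri xw-odd yw-even with partner-edge-cases tri
  ... | inj₁ eq = trans eq (choose-1ℙ (edge x w) (edge y w) xw-odd)
  ... | inj₂ eq = trans eq (choose-0ℙ (edge y w) (edge x w) yw-even)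

  -- t is even, so an odd difference is never a multiple of t
  odd-admissible : ∀ {i j d} → OddEdge (i , j , d) → uncurry Admissible (rep (i , j , d))
  odd-admissible {d = d} (i<j , odd) = (λ i≡j → <-irrefl (cong toℕ i≡j) i<j) , not-multiple
    where
    not-multiple : ¬ (t ∣ toℕ d)
    not-multiple t∣d with ∣-trans (divides half t≡half*2) t∣d
    ... | divides k d≡k*2 = 0ℙ≢1ℙ (trans (sym (parity-+-even 0 k)) (trans (cong ℕ.parity (sym d≡k*2)) odd))
      where
      0ℙ≢1ℙ : 0ℙ ≢ 1ℙ
      0ℙ≢1ℙ ()

  apex : Edge → Pt
  apex e = uncurry third (rep e)

  partner-view : ∀ {e} → OddEdge e →
    let (p , q) = rep e in
    Triangle p q (apex e) × ((side p (apex e) ≡ 1ℙ × partner e ≡ edge p (apex e))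
                           ⊎ (side p (apex e) ≡ 0ℙ × partner e ≡ edge q (apex e)))
  partner-view {e} oe with parity-cases (side (proj₁ (rep e)) (apex e))
  ... | inj₁ odd = third-triangle (odd-admissible oe) , inj₁ (odd , choose-1ℙ _ _ odd)
  ... | inj₂ even = third-triangle (odd-admissible oe) , inj₂ (even , choose-0ℙ _ _ even)

  partner-odd : ∀ {e} → OddEdge e → OddEdge (partner e)
  partner-odd {e@(_ , _ , d)} oe@(_ , pq-odd) with partner-view oe
  ... | (_ , _ , pz , _) , inj₁ (pz-odd , eq) = subst OddEdge (sym eq) (odd-edge pz pz-odd)
  ... | (_ , _ , _ , qz) , inj₂ (pz-even , eq) =
        subst OddEdge (sym eq) (odd-edge qz (odd-even (par Fin.zero) (par d) (par (pos (apex e))) pq-odd pz-even))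

  partner-involutive : ∀ {e} → OddEdge e → partner (partner e) ≡ e
  partner-involutive {e@(i , j , d)} oe@(i<j , pq-odd) with partner-view oe
  ... | tri , inj₁ (pz-odd , eq) = begin
    partner (partner e)     ≡⟨ cong partner eq ⟩
    partner (edge p z)      ≡⟨ partner-of-edge (triangle-132 tri) pq-odd (odd-odd (par Fin.zero) (par d) (par (pos z)) pq-odd pz-odd) ⟩
    edge p q                ≡⟨ edge-rep i<j ⟩
    e                       ∎
    where
    open ≡-Reasoning
    p q z : Pt
    p = ⟨ i , Fin.zero ⟩
    q = ⟨ j , d ⟩
    z = apex e
  ... | tri@(_ , pq , _ , _) , inj₂ (pz-even , eq) = begin
    partner (partner e)     ≡⟨ cong partner eq ⟩
    partner (edge q z)      ≡⟨ partner-of-edge (triangle-132 (triangle-213 tri)) qp-odd zp-even ⟩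
    edge q p                ≡⟨ edge-sym (λ i≡j → pq (sym i≡j)) ⟩
    edge p q                ≡⟨ edge-rep i<j ⟩
    e                       ∎
    where
    open ≡-Reasoning
    p q z : Pt
    p = ⟨ i , Fin.zero ⟩
    q = ⟨ j , d ⟩
    z = apex e
    qp-odd : side q p ≡ 1ℙ
    qp-odd = trans (ℙP.+-comm (par d) (par Fin.zero)) pq-odd
    zp-even : side z p ≡ 0ℙ
    zp-even = trans (ℙP.+-comm (par (pos z)) (par Fin.zero)) pz-even

  -- the partner shares only one group with the original edge
  partner-moves : ∀ {e} → OddEdge e → partner e ≢ e
  partner-moves oe@(i<j , _) partner≡e with partner-view oe
  ... | (_ , _ , _ , qz) , inj₁ (_ , eq) =
        [ (λ j≡i → <-irrefl (cong toℕ (sym j≡i)) i<j) , qz ]′ (proj₂ (edge-groups (trans (sym eq) partner≡e)))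
  ... | (_ , pq , pz , _) , inj₂ (_ , eq) =
        [ pq , pz ]′ (proj₁ (edge-groups (trans (sym eq) partner≡e)))

  OddEdges : Set
  OddEdges = Σ Edge OddEdge

  OddEdges-≡ : ∀ {e e′} {u : OddEdge e} {v : OddEdge e′} → e ≡ e′ → (e , u) ≡ (e′ , v)
  OddEdges-≡ {u = i<j , odd} {v = i<j′ , odd′} refl =
    cong₂ (λ x y → _ , x , y) (<-irrelevant i<j i<j′) (Decidable⇒UIP.≡-irrelevant ℙP._≟_ odd odd′)

  partnerᴼ : OddEdges → OddEdges
  partnerᴼ (e , oe) = partner e , partner-odd oe

  oddEdges↔ : Fin (T n * h) ↔ OddEdges
  oddEdges↔ = ↔-trans *↔× (↔-trans (pairs↔ n ×-↔ odd↔-≡ h M≡h*2) regroup)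
    where
    regroup : (Pairs n × OddFin M) ↔ OddEdges
    regroup = mk↔ₛ′ (λ (((i , j) , i<j) , (d , odd)) → (i , j , d) , i<j , odd)
                    (λ ((i , j , d) , i<j , odd) → ((i , j) , i<j) , (d , odd))
                    (λ _ → refl) (λ _ → refl)

  oddEdges-even : Σ ℕ λ k → T n * h ≡ k + k
  oddEdges-even = involution-even-↔ oddEdges↔ partnerᴼ
    (λ (_ , oe) → OddEdges-≡ (partner-involutive oe))
    (λ (_ , oe) eq → partner-moves oe (cong proj₁ eq))

divide : ∀ x d .{{_ : ℕ.NonZero d}} {r} → x % d ≡ r → x ≡ r + (x / d) * d
divide x d x%d≡r = trans (m≡m%n+[m/n]*n x d) (cong (_+ (x / d) * d) x%d≡r)

-- T (x + 4) = T x + (4x + 6), so T (3 + 4k) has the parity of T 3 = 3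
T-step : ∀ x → T (4 + x) ≡ T x + (3 + x * 2) * 2
T-step x = solve 2 (λ x y → (con 3 :+ x) :+ ((con 2 :+ x) :+ ((con 1 :+ x) :+ (x :+ y)))
                          := y :+ (con 3 :+ x :* con 2) :* con 2) refl x (T x)
  where open +-*-Solver

T-odd : ∀ k → ℕ.parity (T (3 + k * 4)) ≡ 1ℙ
T-odd zero = refl
T-odd (suc k) = trans (cong ℕ.parity (T-step (3 + k * 4)))
                      (trans (parity-+-even (T (3 + k * 4)) (3 + (3 + k * 4) * 2)) (T-odd k))

-- n ≡ 3 or 7 (mod 12) gives n ≡ 3 (mod 4), hence an odd number of pairs of groups
T-odd-for : ∀ n → (n % 12 ≡ 3 ⊎ n % 12 ≡ 7) → ℕ.parity (T n) ≡ 1ℙ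
T-odd-for n hn = subst (λ x → ℕ.parity (T x) ≡ 1ℙ) (sym (divide n 4 n%4≡3)) (T-odd (n / 4))
  where
  n%4≡3 : n % 4 ≡ 3
  n%4≡3 = trans (sym (m∣n⇒o%n%m≡o%m 4 12 n (divides 3 refl)))
                ([ cong (_% 4) , cong (_% 4) ]′ hn)

odd-parity : ∀ m → m % 2 ≡ 1 → ℕ.parity m ≡ 1ℙ
odd-parity m m%2≡1 = trans (cong ℕ.parity (divide m 2 m%2≡1)) (parity-+-even 1 (m / 2))

half-of : ∀ t → t % 4 ≡ 2 → t ≡ (1 + (t / 4) * 2) * 2
half-of t t%4≡2 = trans (divide t 4 t%4≡2)
  (solve 1 (λ s → con 2 :+ s :* con 4 := (con 1 :+ s :* con 2) :* con 2) refl (t / 4))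
  where open +-*-Solver

odd-product : ∀ x y → ℕ.parity x ≡ 1ℙ → ℕ.parity y ≡ 1ℙ → ℕ.parity (x * y) ≡ 1ℙ
odd-product x y x-odd y-odd = trans (ℙP.*-homo-* x y) (cong₂ ℙ._*_ x-odd y-odd)

parity-double : ∀ k → ℕ.parity (k + k) ≡ 0ℙ
parity-double k = trans (ℙP.+-homo-+ k k) (ℙP.p+p≡0ℙ (ℕ.parity k))

lemma4p7 : (n : ℕ) → (n % 12 ≡ 3 ⊎ n % 12 ≡ 7) →
    (m : ℕ) → m % 2 ≡ 1 → (t : ℕ) → t % 4 ≡ 2 → ¬ SCHGDD n m t
lemma4p7 n hn zero () t ht
lemma4p7 n hn (suc a) hm zero ()
lemma4p7 n hn (suc a) hm (suc b) ht D = 1ℙ≢0ℙ (begin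
  1ℙ                                      ≡⟨ sym count-odd ⟩
  ℕ.parity (T n * (suc a * half))         ≡⟨ cong ℕ.parity (proj₂ count-even) ⟩
  ℕ.parity (proj₁ count-even + proj₁ count-even) ≡⟨ parity-double (proj₁ count-even) ⟩
  0ℙ                                      ∎)
  where
  open ≡-Reasoning
  half : ℕ
  half = 1 + (suc b / 4) * 2
  count-even : Σ ℕ λ k → T n * (suc a * half) ≡ k + k
  count-even = Design.oddEdges-even D half (half-of (suc b) ht)
  count-odd : ℕ.parity (T n * (suc a * half)) ≡ 1ℙ
  count-odd = odd-product (T n) (suc a * half) (T-odd-for n hn)
                (odd-product (suc a) half (odd-parity (suc a) hm) (parity-+-even 1 (suc b / 4)))
  1ℙ≢0ℙ : 1ℙ ≢ 0ℙ
  1ℙ≢0ℙ ()
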